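{- Let $n$ be a positive integer, $k=\lceil\log_3 n\rceil$, and let $m$ be an integer with $n\le m<3^k<3n$. Suppose that $m=3^{r}\cdot 14$ with $r\ge 0$ an integer. Then there exist integers $1\le a<b\le n$ such that $b^3+b\equiv a^3+a\pmod{m}$.
   Context: $\lceil x\rceil$ denotes the smallest integer no less than $x$. -}

module Defs where

open import Data.Nat using (ℕ; _≤_; _^_)
open import Data.Product using (_×_)

IsCeilLog3 : ℕ → ℕ → Set
IsCeilLog3 n k = (n ≤ 3 ^ k) × (∀ j → n ≤ 3 ^ j → k ≤ j)

{-# OPTIONS --safe #-}
-- Write m = 14s with s = 3^r. The next power of 3 above 14s is 27s, so n > 9s and
-- a = 1, b = 1 + 7s = 1 + m/2 both lie in [1, n]. Then
-- b³ + b − 2 = (b − 1)(b² + b + 2) = 7s(b² + b + 2), and since s is odd, b is even,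
-- so b² + b + 2 is even and 14s divides the difference.
module Submission where

open import Defs
open import Data.Nat using (ℕ; _≤_; _<_; _^_; _*_; _+_; _∸_; NonZero; suc; zero; z≤n; s≤s; _≤?_)
open import Data.Nat.Properties
open import Data.Nat.Divisibility using (divides)
open import Data.Nat.Tactic.RingSolver using (solve-∀)
open import Data.Product using (_×_; ∃-syntax; _,_)
open import Relation.Binary.PropositionalEquality
open import Relation.Nullary using (yes; no; contradiction)
open import Data.Integer as ℤ using (+_)
open import Data.Integer.Divisibility using (_∣_)
import Data.Integer.Properties as ℤ

m^i<m^k⇒m^[1+i]≤m^k : ∀ m .{{_ : NonZero m}} i {k} → m ^ i < m ^ k → m ^ suc i ≤ m ^ k
m^i<m^k⇒m^[1+i]≤m^k m i {k} m^i<m^k with suc i ≤? k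
... | yes i<k = ^-monoʳ-≤ m i<k
... | no  i≮k = contradiction (^-monoʳ-≤ m (≮⇒≥ i≮k)) (<⇒≱ m^i<m^k)

3^n-odd : ∀ n → ∃[ t ] 3 ^ n ≡ 1 + 2 * t
3^n-odd zero = 0 , refl
3^n-odd (suc n) with 3^n-odd n
... | t , 3^n≡1+2t = 1 + 3 * t , trans (cong (3 *_) 3^n≡1+2t) (triple-odd t)
  where
    triple-odd : ∀ t → 3 * (1 + 2 * t) ≡ 1 + 2 * (1 + 3 * t)
    triple-odd = solve-∀

[1+7s]³+[1+7s]≡q*14s+2 : ∀ t → (1 + 7 * (1 + 2 * t)) ^ 3 + (1 + 7 * (1 + 2 * t))
  ≡ (37 + 119 * t + 98 * (t * t)) * ((1 + 2 * t) * 14) + 2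
[1+7s]³+[1+7s]≡q*14s+2 = unfolded-cube
  where
    -- the ring solver reads _^_ as its own operator, so the cube is unfolded first
    unfolded-cube : ∀ t → let b = 1 + 7 * (1 + 2 * t) in b * (b * (b * 1)) + b
      ≡ (37 + 119 * t + 98 * (t * t)) * ((1 + 2 * t) * 14) + 2
    unfolded-cube = solve-∀

x≡q*M+y⇒M∣x-y : ∀ {x y} q M → x ≡ q * M + y → (+ M) ∣ (+ x ℤ.- + y)
x≡q*M+y⇒M∣x-y {x} {y} q M x≡qM+y = divides q (cong ℤ.∣_∣ x-y≡qM)
  where
    open ≡-Reasoning
    x-y≡qM : + x ℤ.- + y ≡ + (q * M)
    x-y≡qM = begin
      + x ℤ.- + y        ≡⟨ ℤ.[+m]-[+n]≡m⊖n x y ⟩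
      x ℤ.⊖ y            ≡⟨ ℤ.⊖-≥ (subst (y ≤_) (sym x≡qM+y) (m≤n+m y (q * M))) ⟩
      + (x ∸ y)          ≡⟨ cong (λ z → + (z ∸ y)) x≡qM+y ⟩
      + (q * M + y ∸ y)  ≡⟨ cong +_ (m+n∸n≡m (q * M) y) ⟩
      + (q * M)          ∎

lemma4p5 : (n k m r : ℕ) → 1 ≤ n → IsCeilLog3 n k →
    n ≤ m → m < 3 ^ k → 3 ^ k < 3 * n → m ≡ 3 ^ r * 14 →
    ∃[ a ] ∃[ b ] (1 ≤ a × a < b × b ≤ n ×
    (+ m) ∣ ((+ (b ^ 3) ℤ.+ + b) ℤ.- (+ (a ^ 3) ℤ.+ + a)))
lemma4p5 n k m r _ _ _ m<3^k 3^k<3n refl with 3^n-odd r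
... | t , s≡1+2t = 1 , b , s≤s z≤n , 1<b , b≤n , m∣b³+b-2
  where
    s = 3 ^ r
    b = 1 + 7 * s
    1<b : 1 < b
    1<b = s≤s (≤-trans (m^n>0 3 r) (m≤n*m s 7))
    9s≡3^[2+r] : 9 * s ≡ 3 ^ (2 + r)
    9s≡3^[2+r] = *-assoc 3 3 s
    3^[2+r]<3^k : 3 ^ (2 + r) < 3 ^ k
    3^[2+r]<3^k = begin-strict
      3 ^ (2 + r) ≡⟨ 9s≡3^[2+r] ⟨
      9 * s       ≤⟨ *-monoˡ-≤ s (m≤m+n 9 5) ⟩
      14 * s      ≡⟨ *-comm 14 s ⟩
      s * 14      <⟨ m<3^k ⟩
      3 ^ k       ∎
      where open ≤-Reasoning
    9s<n : 9 * s < n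
    9s<n = subst (_< n) (sym 9s≡3^[2+r])
      (*-cancelˡ-< 3 (3 ^ (2 + r)) n (≤-<-trans (m^i<m^k⇒m^[1+i]≤m^k 3 (2 + r) {k} 3^[2+r]<3^k) 3^k<3n))
    b≤n : b ≤ n
    b≤n = ≤-trans (s≤s (*-monoˡ-≤ s (m≤m+n 7 2))) 9s<n
    m∣b³+b-2 : (+ (s * 14)) ∣ ((+ (b ^ 3) ℤ.+ + b) ℤ.- + 2)
    m∣b³+b-2 rewrite sym (ℤ.pos-+ (b ^ 3) b) | s≡1+2t =
      x≡q*M+y⇒M∣x-y (37 + 119 * t + 98 * (t * t)) ((1 + 2 * t) * 14) ([1+7s]³+[1+7s]≡q*14s+2 t)
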